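{- Let $(P,\le)$ be a finite poset with elements $s_1,\dots,s_n$, let $\mathbb{K}$ be a field, and let $H$ be an $n\times n$ matrix over $\mathbb{K}$ such that $H_{ij}=0$ unless $s_i\le s_j$ (i.e. $H$ represents an element of the incidence algebra $I(P,\mathbb{K})$) and $H_{ii}=1$ for $1\le i\le n$. Then there exists a linear SDS over $\mathbb{K}$ whose system map equals $H^{ -1}$.
   Context: The incidence algebra $I(P,\mathbb{K})$ consists of functions $h$ on intervals $[x,y]$ ($x\le y$) of $P$ with values in $\mathbb{K}$, with product $hr(x,y)=\sum_{x\le z\le y}h(x,z)r(z,y)$; $h$ is represented by the matrix $H$ with $H_{ij}=h(s_i,s_j)$ if $s_i\le s_j$ and $0$ otherwise. A linear SDS $(G,A,\pi)$: $G$ is a connected simple graph with vertices $v_1,\dots,v_n$; $A=(a_{ij})$ is an $n\times n$ matrix over $\mathbb{K}$ with $a_{ij}=0$ whenever $i\neq j$ and $v_i,v_j$ are not adjacent; the local function of $v_i$ is $x_i\mapsto a_{i1}x_1+\cdots+a_{in}x_n$, inducing the matrix $F_{v_i}$ equal to the identity except that its $i$-th row is $(a_{i1},\dots,a_{in})$. For a permutation $\pi=\pi_1\cdots\pi_n$ of the vertices, the system map is $(G,A,\pi)=F_{\pi_n}\cdots F_{\pi_1}$. -}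

module Defs where

open import Level using (Level; _⊔_; suc)
open import Data.Nat using (ℕ; zero) renaming (suc to sucℕ)
open import Data.Fin using (Fin; _≟_) renaming (zero to fzero; suc to fsuc)
open import Data.Bool using (Bool; true; false)
open import Data.List using (List; foldl; map)
open import Data.Vec.Functional using (toList)
open import Data.Fin.Permutation using (Permutation′; _⟨$⟩ʳ_)
open import Data.Product using (Σ; ∃; _×_; _,_)
open import Relation.Nullary using (¬_; yes; no)
open import Relation.Binary.PropositionalEquality using (_≡_)
open import Relation.Binary.Construct.Closure.ReflexiveTransitive using (Star)
open import Algebra.Bundles using (CommutativeRing)

record Field (c ℓ : Level) : Set (suc (c ⊔ ℓ)) where
  field
    commutativeRing : CommutativeRing c ℓ
  open CommutativeRing commutativeRing public
  field
    0≉1     : ¬ (0# ≈ 1#)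
    inverse : ∀ x → ¬ (x ≈ 0#) → ∃ λ y → (x * y) ≈ 1#

record SimpleGraph (n : ℕ) : Set where
  field
    adj     : Fin n → Fin n → Bool
    adj-sym : ∀ i j → adj i j ≡ adj j i
    irrefl  : ∀ i → adj i i ≡ false

  Adjacent : Fin n → Fin n → Set
  Adjacent i j = adj i j ≡ true

Connected : ∀ {n} → SimpleGraph n → Set
Connected G = ∀ i j → Star (SimpleGraph.Adjacent G) i j

module _ {c ℓ : Level} (𝕂 : Field c ℓ) where
  open Field 𝕂

  Matrix : ℕ → Set c
  Matrix n = Fin n → Fin n → Carrier

  ∑ : ∀ {n} → (Fin n → Carrier) → Carrier
  ∑ {zero}   f = 0#
  ∑ {sucℕ n} f = f fzero + ∑ (λ k → f (fsuc k))

  _·_ : ∀ {n} → Matrix n → Matrix n → Matrix n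
  (M · N) i j = ∑ (λ k → M i k * N k j)

  𝟙 : ∀ {n} → Matrix n
  𝟙 i j with i ≟ j
  ... | yes _ = 1#
  ... | no  _ = 0#

  _≈ᴹ_ : ∀ {n} → Matrix n → Matrix n → Set ℓ
  M ≈ᴹ N = ∀ i j → M i j ≈ N i j

  record LinearSDS (n : ℕ) : Set (c ⊔ ℓ) where
    field
      graph     : SimpleGraph n
      connected : Connected graph
      A         : Matrix n
      A-support : ∀ i j → ¬ (i ≡ j) → ¬ SimpleGraph.Adjacent graph i j → A i j ≈ 0#
      π         : Permutation′ n

  -- F_v : identity except that row v is row v of A
  localMatrix : ∀ {n} → Matrix n → Fin n → Matrix n
  localMatrix A v i j with i ≟ v
  ... | yes _ = A v j
  ... | no  _ = 𝟙 i j

  -- system map (G, A, π) = F_{π_n} ⋯ F_{π_1}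
  systemMap : ∀ {n} → LinearSDS n → Matrix n
  systemMap {n} S =
    foldl (λ M v → localMatrix A v · M) 𝟙 (toList (λ k → π ⟨$⟩ʳ k))
    where open LinearSDS S

module Submission where

-- Use the complete graph, so that the matrix A is unconstrained,
-- and update the vertices in the order 0, 1, …, n-1.  Let `reduced k` be H
-- with its rows of index < k replaced by identity rows; reduced 0 = H,
-- reduced n = 𝟙, and each reduced k is again unitriangular, hence has a
-- left inverse.  Choose row k of A to be row k of a left inverse of
-- reduced k.  If M ⊙ H ≈ reduced k, then F_k ⊙ M ⊙ H ≈ reduced (k+1): F_k
-- only changes row k, and turns it into the identity row.  So the system
-- map S satisfies S ⊙ H ≈ 𝟙 (module Sweep).
--
-- The order is not
-- assumed decidable, so unitriangularity is tracked up to double negation,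
-- which still suffices to invert the pivots.

open import Defs
open import Level using (Level; _⊔_)
open import Function using (flip; _∘_)
open import Data.Nat as ℕ using (ℕ; zero; suc; _<?_)
import Data.Nat.Properties as ℕₚ
open import Data.Fin using (Fin; toℕ; _≟_) renaming (zero to fzero; suc to fsuc)
open import Data.Fin.Properties using (suc-injective; toℕ-injective; toℕ<n)
open import Data.Bool using (false; not)
open import Data.List using (foldl; tabulate)
open import Data.Product using (∃; _×_; _,_; proj₁; proj₂)
open import Relation.Nullary using (¬_; yes; no; does)
open import Relation.Nullary.Negation using (contradiction; ¬¬-map)
open import Relation.Binary.Structures using (IsPartialOrder)
open import Relation.Binary.PropositionalEquality as ≡ using (_≡_; _≢_)
open import Relation.Binary.Construct.Closure.ReflexiveTransitive using (ε; _◅_)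
import Data.Fin.Permutation as Permutation

private
  variable
    a ℓ ℓ′ : Level
    X Y Z : Set a

¬¬-map₂ : (X → Y → Z) → ¬ ¬ X → ¬ ¬ Y → ¬ ¬ Z
¬¬-map₂ f ¬¬x ¬¬y ¬z = ¬¬x (λ x → ¬¬y (λ y → ¬z (f x y)))

¬¬-by-cases : ¬ (X × Y) → (¬ X → ¬ ¬ Z) → (¬ Y → ¬ ¬ Z) → ¬ ¬ Z
¬¬-by-cases ¬both from¬x from¬y ¬z =
  from¬y (λ y → from¬x (λ x → ¬both (x , y)) ¬z) ¬z

restrict : ∀ {n} {_≤_ : Fin (suc n) → Fin (suc n) → Set ℓ} →
           IsPartialOrder _≡_ _≤_ → IsPartialOrder _≡_ (λ i j → fsuc i ≤ fsuc j)
restrict po = record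
  { isPreorder = record
    { isEquivalence = ≡.isEquivalence
    ; reflexive     = λ i≡j → reflexive (≡.cong fsuc i≡j)
    ; trans         = trans
    }
  ; antisym = λ i≤j j≤i → suc-injective (antisym i≤j j≤i)
  }
  where open IsPartialOrder po

opposite : {_≤_ : X → X → Set ℓ} → IsPartialOrder _≡_ _≤_ → IsPartialOrder _≡_ (flip _≤_)
opposite po = record
  { isPreorder = record
    { isEquivalence = ≡.isEquivalence
    ; reflexive     = λ i≡j → reflexive (≡.sym i≡j)
    ; trans         = λ j≤i k≤j → trans k≤j j≤i
    }
  ; antisym = λ j≤i i≤j → antisym i≤j j≤i
  }
  where open IsPartialOrder po

-- The complete graph on n vertices: distinct vertices are adjacent, so a
-- linear SDS over it may use an arbitrary matrix A.
complete : ∀ n → SimpleGraph n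
complete n = record
  { adj     = λ i j → not (does (i ≟ j))
  ; adj-sym = symmetric
  ; irrefl  = irreflexive
  }
  where
  symmetric : ∀ (i j : Fin n) → not (does (i ≟ j)) ≡ not (does (j ≟ i))
  symmetric i j with i ≟ j | j ≟ i
  ... | yes _   | yes _   = ≡.refl
  ... | yes i≡j | no j≢i  = contradiction (≡.sym i≡j) j≢i
  ... | no i≢j  | yes j≡i = contradiction (≡.sym j≡i) i≢j
  ... | no _    | no _    = ≡.refl
  irreflexive : ∀ (i : Fin n) → not (does (i ≟ i)) ≡ false
  irreflexive i with i ≟ i
  ... | yes _  = ≡.refl
  ... | no i≢i = contradiction ≡.refl i≢i

complete-adjacent : ∀ {n} {i j : Fin n} → i ≢ j → SimpleGraph.Adjacent (complete n) i j
complete-adjacent {i = i} {j} i≢j with i ≟ j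
... | yes i≡j = contradiction i≡j i≢j
... | no _    = ≡.refl

complete-connected : ∀ n → Connected (complete n)
complete-connected n i j with i ≟ j
... | yes ≡.refl = ε
... | no i≢j     = complete-adjacent i≢j ◅ ε

module MatrixAlgebra {c ℓ : Level} (𝕂 : Field c ℓ) where
  open Field 𝕂
  open import Algebra.Properties.Semiring.Sum semiring
    using (sum; sum-cong-≋; sum-replicate-zero; ∑-comm; *-distribˡ-sum; *-distribʳ-sum)
  open import Algebra.Properties.Ring ring using (-1*x≈-x; -‿distribˡ-*)
  open import Relation.Binary.Reasoning.Setoid setoid

  Mat : ℕ → Set c
  Mat = Matrix 𝕂

  ∑ᴷ : ∀ {n} → (Fin n → Carrier) → Carrier
  ∑ᴷ = ∑ 𝕂

  I : ∀ {n} → Mat n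
  I = 𝟙 𝕂

  infixl 7 _⊙_ _ᵛ⊙_
  infix  4 _≋_

  _⊙_ : ∀ {n} → Mat n → Mat n → Mat n
  _⊙_ = _·_ 𝕂

  _≋_ : ∀ {n} → Mat n → Mat n → Set ℓ
  _≋_ = _≈ᴹ_ 𝕂

  _ᵛ⊙_ : ∀ {n} → (Fin n → Carrier) → Mat n → Fin n → Carrier
  (x ᵛ⊙ M) j = ∑ᴷ (λ k → x k * M k j)

  _ᵀ : ∀ {n} → Mat n → Mat n
  (M ᵀ) i j = M j i

  -- The sum of Defs is the library's right-fold `sum`, so the library's
  -- summation lemmas apply to it.
  ∑ᴷ≡sum : ∀ {n} (f : Fin n → Carrier) → ∑ᴷ f ≡ sum f
  ∑ᴷ≡sum {zero}  f = ≡.refl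
  ∑ᴷ≡sum {suc n} f = ≡.cong (f fzero +_) (∑ᴷ≡sum (λ k → f (fsuc k)))

  ∑-cong : ∀ {n} {f g : Fin n → Carrier} → (∀ i → f i ≈ g i) → ∑ᴷ f ≈ ∑ᴷ g
  ∑-cong {f = f} {g} f≈g rewrite ∑ᴷ≡sum f | ∑ᴷ≡sum g = sum-cong-≋ f≈g

  ∑-zero : ∀ {n} {f : Fin n → Carrier} → (∀ i → f i ≈ 0#) → ∑ᴷ f ≈ 0#
  ∑-zero {n} {f} f≈0 rewrite ∑ᴷ≡sum f = trans (sum-cong-≋ f≈0) (sum-replicate-zero n)

  ∑-*ˡ : ∀ {n} x (f : Fin n → Carrier) → x * ∑ᴷ f ≈ ∑ᴷ (λ i → x * f i)
  ∑-*ˡ x f rewrite ∑ᴷ≡sum f | ∑ᴷ≡sum (λ i → x * f i) = *-distribˡ-sum x f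

  ∑-*ʳ : ∀ {n} x (f : Fin n → Carrier) → ∑ᴷ f * x ≈ ∑ᴷ (λ i → f i * x)
  ∑-*ʳ x f rewrite ∑ᴷ≡sum f | ∑ᴷ≡sum (λ i → f i * x) = *-distribʳ-sum x f

  ∑-neg : ∀ {n} (f : Fin n → Carrier) → - ∑ᴷ f ≈ ∑ᴷ (λ i → - f i)
  ∑-neg f = begin
    - ∑ᴷ f                     ≈⟨ -1*x≈-x (∑ᴷ f) ⟨
    - 1# * ∑ᴷ f                ≈⟨ ∑-*ˡ (- 1#) f ⟩
    ∑ᴷ (λ i → - 1# * f i)      ≈⟨ ∑-cong (λ i → -1*x≈-x (f i)) ⟩
    ∑ᴷ (λ i → - f i)           ∎

  ∑-swap : ∀ {m n} (f : Fin m → Fin n → Carrier) →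
           ∑ᴷ (λ i → ∑ᴷ (λ j → f i j)) ≈ ∑ᴷ (λ j → ∑ᴷ (λ i → f i j))
  ∑-swap f = begin
    ∑ᴷ (λ i → ∑ᴷ (λ j → f i j))   ≈⟨ ∑-cong (λ i → reflexive (∑ᴷ≡sum (f i))) ⟩
    ∑ᴷ (λ i → sum (f i))          ≡⟨ ∑ᴷ≡sum (λ i → sum (f i)) ⟩
    sum (λ i → sum (f i))         ≈⟨ ∑-comm f ⟩
    sum (λ j → sum (λ i → f i j)) ≡⟨ ∑ᴷ≡sum (λ j → sum (λ i → f i j)) ⟨
    ∑ᴷ (λ j → sum (λ i → f i j))  ≈⟨ ∑-cong (λ j → reflexive (∑ᴷ≡sum (λ i → f i j))) ⟨
    ∑ᴷ (λ j → ∑ᴷ (λ i → f i j))   ∎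

  𝟙-diag : ∀ {n} (i : Fin n) → I i i ≈ 1#
  𝟙-diag i with i ≟ i
  ... | yes _  = refl
  ... | no i≢i = contradiction ≡.refl i≢i

  𝟙-off : ∀ {n} {i j : Fin n} → i ≢ j → I i j ≈ 0#
  𝟙-off {i = i} {j} i≢j with i ≟ j
  ... | yes i≡j = contradiction i≡j i≢j
  ... | no _    = refl

  𝟙-suc : ∀ {n} (i j : Fin n) → I (fsuc i) (fsuc j) ≈ I i j
  𝟙-suc i j with i ≟ j
  ... | yes _ = refl
  ... | no _  = refl

  𝟙-sym : ∀ {n} (i j : Fin n) → I i j ≈ I j i
  𝟙-sym i j with i ≟ j
  ... | yes ≡.refl = sym (𝟙-diag i)
  ... | no i≢j     = sym (𝟙-off (i≢j ∘ ≡.sym))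

  ∑-δˡ : ∀ {n} (f : Fin n → Carrier) (i : Fin n) → ∑ᴷ (λ l → I i l * f l) ≈ f i
  ∑-δˡ f fzero = begin
    1# * f fzero + ∑ᴷ (λ l → 0# * f (fsuc l)) ≈⟨ +-cong (*-identityˡ _) (∑-zero (λ l → zeroˡ (f (fsuc l)))) ⟩
    f fzero + 0#                              ≈⟨ +-identityʳ _ ⟩
    f fzero                                   ∎
  ∑-δˡ f (fsuc i) = begin
    0# * f fzero + ∑ᴷ (λ l → I (fsuc i) (fsuc l) * f (fsuc l))
      ≈⟨ +-cong (zeroˡ _) (∑-cong (λ l → *-congʳ (𝟙-suc i l))) ⟩
    0# + ∑ᴷ (λ l → I i l * f (fsuc l)) ≈⟨ +-identityˡ _ ⟩
    ∑ᴷ (λ l → I i l * f (fsuc l))      ≈⟨ ∑-δˡ (f ∘ fsuc) i ⟩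
    f (fsuc i)                         ∎

  ᵛ⊙-cong : ∀ {n} (x : Fin n → Carrier) {M N : Mat n} → M ≋ N → ∀ j → (x ᵛ⊙ M) j ≈ (x ᵛ⊙ N) j
  ᵛ⊙-cong x M≈N j = ∑-cong (λ k → *-congˡ (M≈N k j))

  ᵛ⊙-assoc : ∀ {n} (x : Fin n → Carrier) (M N : Mat n) j →
             ((x ᵛ⊙ M) ᵛ⊙ N) j ≈ (x ᵛ⊙ (M ⊙ N)) j
  ᵛ⊙-assoc x M N j = begin
    ∑ᴷ (λ k → ∑ᴷ (λ l → x l * M l k) * N k j)   ≈⟨ ∑-cong (λ k → ∑-*ʳ (N k j) (λ l → x l * M l k)) ⟩
    ∑ᴷ (λ k → ∑ᴷ (λ l → x l * M l k * N k j))   ≈⟨ ∑-swap (λ k l → x l * M l k * N k j) ⟩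
    ∑ᴷ (λ l → ∑ᴷ (λ k → x l * M l k * N k j))   ≈⟨ ∑-cong (λ l → ∑-cong (λ k → *-assoc (x l) (M l k) (N k j))) ⟩
    ∑ᴷ (λ l → ∑ᴷ (λ k → x l * (M l k * N k j))) ≈⟨ ∑-cong (λ l → ∑-*ˡ (x l) (λ k → M l k * N k j)) ⟨
    ∑ᴷ (λ l → x l * (M ⊙ N) l j)                ∎

  ᵛ⊙-identity : ∀ {n} (x : Fin n → Carrier) j → (x ᵛ⊙ I) j ≈ x j
  ᵛ⊙-identity x j = trans (∑-cong (λ l → trans (*-comm _ _) (*-congʳ (𝟙-sym l j)))) (∑-δˡ x j)

  ᵛ⊙-neg : ∀ {n} (x : Fin n → Carrier) (M : Mat n) j → ((λ k → - x k) ᵛ⊙ M) j ≈ - (x ᵛ⊙ M) j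
  ᵛ⊙-neg x M j = begin
    ∑ᴷ (λ k → - x k * M k j)   ≈⟨ ∑-cong (λ k → -‿distribˡ-* (x k) (M k j)) ⟨
    ∑ᴷ (λ k → - (x k * M k j)) ≈⟨ ∑-neg (λ k → x k * M k j) ⟨
    - (x ᵛ⊙ M) j               ∎

  ⊙-congˡ : ∀ {n} (L : Mat n) {M N : Mat n} → M ≋ N → L ⊙ M ≋ L ⊙ N
  ⊙-congˡ L M≈N i = ᵛ⊙-cong (L i) M≈N

  ⊙-congʳ : ∀ {n} {L M : Mat n} (N : Mat n) → L ≋ M → L ⊙ N ≋ M ⊙ N
  ⊙-congʳ N L≈M i j = ∑-cong (λ k → *-congʳ (L≈M i k))

  ⊙-assoc : ∀ {n} (L M N : Mat n) → (L ⊙ M) ⊙ N ≋ L ⊙ (M ⊙ N)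
  ⊙-assoc L M N i = ᵛ⊙-assoc (L i) M N

  ⊙-identityˡ : ∀ {n} (M : Mat n) → I ⊙ M ≋ M
  ⊙-identityˡ M i j = ∑-δˡ (λ k → M k j) i

  ⊙-identityʳ : ∀ {n} (M : Mat n) → M ⊙ I ≋ M
  ⊙-identityʳ M i = ᵛ⊙-identity (M i)

  transpose-inverse : ∀ {n} {M T : Mat n} → T ⊙ M ᵀ ≋ I → M ⊙ T ᵀ ≋ I
  transpose-inverse {M = M} {T} TMᵀ≈I i j =
    trans (∑-cong (λ k → *-comm (M i k) (T j k))) (trans (TMᵀ≈I j i) (𝟙-sym j i))

  left-inverse-is-two-sided : ∀ {n} {L M R : Mat n} → L ⊙ M ≋ I → M ⊙ R ≋ I → M ⊙ L ≋ I
  left-inverse-is-two-sided {L = L} {M} {R} LM≈I MR≈I i j = begin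
    (M ⊙ L) i j ≈⟨ ⊙-congˡ M L≈R i j ⟩
    (M ⊙ R) i j ≈⟨ MR≈I i j ⟩
    I i j       ∎
    where
    L≈R : L ≋ R
    L≈R k l = begin
      L k l             ≈⟨ ⊙-identityʳ L k l ⟨
      (L ⊙ I) k l       ≈⟨ ⊙-congˡ L MR≈I k l ⟨
      (L ⊙ (M ⊙ R)) k l ≈⟨ ⊙-assoc L M R k l ⟨
      ((L ⊙ M) ⊙ R) k l ≈⟨ ⊙-congʳ R LM≈I k l ⟩
      (I ⊙ R) k l       ≈⟨ ⊙-identityˡ R k l ⟩
      R k l             ∎

module Unitriangular {c ℓ : Level} (𝕂 : Field c ℓ) where
  open Field 𝕂
  open MatrixAlgebra 𝕂
  open import Algebra.Properties.Ring ring using (-‿distribˡ-*; -0#≈0#)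
  open import Relation.Binary.Reasoning.Setoid setoid

  -- H i j ≈ 0 off the order and H i i ≈ 1, both up to double negation:
  -- without decidability of ≤ this is what survives Schur complements.
  record IsUnitriangular {n : ℕ} (_≤_ : Fin n → Fin n → Set ℓ′) (H : Mat n) : Set (ℓ ⊔ ℓ′) where
    field
      off-support : ∀ i j → ¬ (i ≤ j) → ¬ ¬ (H i j ≈ 0#)
      diagonal    : ∀ i → ¬ ¬ (H i i ≈ 1#)

  invert-unit : ∀ {h} → ¬ ¬ (h ≈ 1#) → ∃ λ y → y * h ≈ 1#
  invert-unit {h} ¬¬h≈1 with inverse h (λ h≈0 → ¬¬h≈1 (λ h≈1 → 0≉1 (trans (sym h≈0) h≈1)))
  ... | y , hy≈1 = y , trans (*-comm y h) hy≈1

  block : ∀ {n} → Carrier → (Fin n → Carrier) → (Fin n → Carrier) → Mat n → Mat (suc n)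
  block a row col M fzero    fzero    = a
  block a row col M fzero    (fsuc j) = row j
  block a row col M (fsuc i) fzero    = col i
  block a row col M (fsuc i) (fsuc j) = M i j

  first-row first-col : ∀ {n} → Mat (suc n) → Fin n → Carrier
  first-row H j = H fzero (fsuc j)
  first-col H i = H (fsuc i) fzero

  minor : ∀ {n} → Mat (suc n) → Mat n
  minor H i j = H (fsuc i) (fsuc j)

  schur : ∀ {n} → Carrier → Mat (suc n) → Mat n
  schur y H i j = minor H i j - first-col H i * y * first-row H j

  clear-first-column : ∀ {n} (H : Mat (suc n)) {y} → y * H fzero fzero ≈ 1# →
    block y (λ _ → 0#) (λ i → - (first-col H i * y)) I ⊙ H
      ≋ block 1# (λ j → y * first-row H j) (λ _ → 0#) (schur y H)
  clear-first-column H {y} yh≈1 fzero fzero = begin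
    y * H fzero fzero + ∑ᴷ (λ k → 0# * first-col H k) ≈⟨ +-cong yh≈1 (∑-zero (λ k → zeroˡ (first-col H k))) ⟩
    1# + 0#                                           ≈⟨ +-identityʳ 1# ⟩
    1#                                                ∎
  clear-first-column H {y} yh≈1 fzero (fsuc j) = begin
    y * first-row H j + ∑ᴷ (λ k → 0# * minor H k j) ≈⟨ +-congˡ (∑-zero (λ k → zeroˡ (minor H k j))) ⟩
    y * first-row H j + 0#                          ≈⟨ +-identityʳ _ ⟩
    y * first-row H j                               ∎
  clear-first-column H {y} yh≈1 (fsuc i) fzero = begin
    - (first-col H i * y) * H fzero fzero + ∑ᴷ (λ k → I i k * first-col H k)
      ≈⟨ +-cong (sym (-‿distribˡ-* _ _)) (∑-δˡ (first-col H) i) ⟩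
    - (first-col H i * y * H fzero fzero) + first-col H i
      ≈⟨ +-congʳ (-‿cong (trans (*-assoc _ _ _) (trans (*-congˡ yh≈1) (*-identityʳ _)))) ⟩
    - first-col H i + first-col H i ≈⟨ -‿inverseˡ _ ⟩
    0#                              ∎
  clear-first-column H {y} yh≈1 (fsuc i) (fsuc j) = begin
    - (first-col H i * y) * first-row H j + ∑ᴷ (λ k → I i k * minor H k j)
      ≈⟨ +-cong (sym (-‿distribˡ-* _ _)) (∑-δˡ (λ k → minor H k j) i) ⟩
    - (first-col H i * y * first-row H j) + minor H i j ≈⟨ +-comm _ _ ⟩
    schur y H i j                                       ∎

  unipotent-inverse : ∀ {n} (x : Fin n → Carrier) {S T : Mat n} → T ⊙ S ≋ I →
    block 1# (λ j → - (x ᵛ⊙ T) j) (λ _ → 0#) T ⊙ block 1# x (λ _ → 0#) S ≋ I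
  unipotent-inverse x {S} {T} TS≈I fzero fzero = begin
    1# * 1# + ∑ᴷ (λ k → - (x ᵛ⊙ T) k * 0#) ≈⟨ +-cong (*-identityˡ 1#) (∑-zero (λ k → zeroʳ (- (x ᵛ⊙ T) k))) ⟩
    1# + 0#                                ≈⟨ +-identityʳ 1# ⟩
    1#                                     ∎
  unipotent-inverse x {S} {T} TS≈I fzero (fsuc j) = begin
    1# * x j + ((λ k → - (x ᵛ⊙ T) k) ᵛ⊙ S) j ≈⟨ +-cong (*-identityˡ (x j)) (ᵛ⊙-neg (x ᵛ⊙ T) S j) ⟩
    x j + - ((x ᵛ⊙ T) ᵛ⊙ S) j               ≈⟨ +-congˡ (-‿cong (ᵛ⊙-assoc x T S j)) ⟩
    x j + - (x ᵛ⊙ (T ⊙ S)) j                ≈⟨ +-congˡ (-‿cong (trans (ᵛ⊙-cong x TS≈I j) (ᵛ⊙-identity x j))) ⟩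
    x j + - x j                             ≈⟨ -‿inverseʳ (x j) ⟩
    0#                                      ∎
  unipotent-inverse x {S} {T} TS≈I (fsuc i) fzero = begin
    0# * 1# + ∑ᴷ (λ k → T i k * 0#) ≈⟨ +-cong (zeroˡ 1#) (∑-zero (λ k → zeroʳ (T i k))) ⟩
    0# + 0#                         ≈⟨ +-identityʳ 0# ⟩
    0#                              ∎
  unipotent-inverse x {S} {T} TS≈I (fsuc i) (fsuc j) = begin
    0# * x j + (T ⊙ S) i j ≈⟨ +-cong (zeroˡ (x j)) (TS≈I i j) ⟩
    0# + I i j             ≈⟨ +-identityˡ (I i j) ⟩
    I i j                  ≈⟨ 𝟙-suc i j ⟨
    I (fsuc i) (fsuc j)    ∎

  -- The Schur complement of a unitriangular matrix is unitriangular for the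
  -- restricted order: the correction term col a * y * row b vanishes (up to
  -- double negation) because a ≤ 0 ≤ b would force a ≤ b, resp. a = 0.
  schur-unitriangular : ∀ {n} {_≤_ : Fin (suc n) → Fin (suc n) → Set ℓ′} →
    IsPartialOrder _≡_ _≤_ → (H : Mat (suc n)) → IsUnitriangular _≤_ H → ∀ y →
    IsUnitriangular (λ i j → fsuc i ≤ fsuc j) (schur y H)
  schur-unitriangular {_≤_ = _≤_} po H unit y = record
    { off-support = λ a b a≰b →
        ¬¬-map₂ subtract-zero (off-support (fsuc a) (fsuc b) a≰b)
                              (correction-vanishes a b (λ (a≤0 , 0≤b) → a≰b (≤-trans a≤0 0≤b)))
    ; diagonal = λ a →
        ¬¬-map₂ subtract-zero (diagonal (fsuc a))
                              (correction-vanishes a a (λ (a≤0 , 0≤a) → suc≢zero (antisym a≤0 0≤a)))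
    }
    where
    open IsUnitriangular unit
    open IsPartialOrder po using (antisym) renaming (trans to ≤-trans)

    suc≢zero : ∀ {a} → fsuc a ≢ fzero
    suc≢zero ()

    subtract-zero : ∀ {u v z} → u ≈ v → z ≈ 0# → u - z ≈ v
    subtract-zero {u} {v} u≈v z≈0 = begin
      u + - _ ≈⟨ +-cong u≈v (trans (-‿cong z≈0) -0#≈0#) ⟩
      v + 0#  ≈⟨ +-identityʳ v ⟩
      v       ∎

    correction-vanishes : ∀ a b → ¬ (fsuc a ≤ fzero × fzero ≤ fsuc b) →
                          ¬ ¬ (first-col H a * y * first-row H b ≈ 0#)
    correction-vanishes a b not-both = ¬¬-by-cases not-both
      (λ a≰0 → ¬¬-map (λ col≈0 → trans (*-congʳ (trans (*-congʳ col≈0) (zeroˡ y))) (zeroˡ _))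
                      (off-support (fsuc a) fzero a≰0))
      (λ 0≰b → ¬¬-map (λ row≈0 → trans (*-congˡ row≈0) (zeroʳ _))
                      (off-support fzero (fsuc b) 0≰b))

  -- Every unitriangular matrix has a left inverse: clear the first column,
  -- invert the Schur complement recursively, and invert the resulting
  -- unipotent block matrix.
  left-inverse : ∀ n {_≤_ : Fin n → Fin n → Set ℓ′} → IsPartialOrder _≡_ _≤_ →
                 (H : Mat n) → IsUnitriangular _≤_ H → ∃ λ T → T ⊙ H ≋ I
  left-inverse zero    po H unit = (λ ()) , (λ ())
  left-inverse (suc n) po H unit = U ⊙ E , UE⊙H≈I
    where
    pivot : ∃ λ y → y * H fzero fzero ≈ 1#
    pivot = invert-unit (IsUnitriangular.diagonal unit fzero)
    y : Carrier
    y = proj₁ pivot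
    recursion : ∃ λ T → T ⊙ schur y H ≋ I
    recursion = left-inverse n (restrict po) (schur y H) (schur-unitriangular po H unit y)
    T : Mat n
    T = proj₁ recursion
    x : Fin n → Carrier
    x j = y * first-row H j
    E U : Mat (suc n)
    E = block y (λ _ → 0#) (λ i → - (first-col H i * y)) I
    U = block 1# (λ j → - (x ᵛ⊙ T) j) (λ _ → 0#) T

    UE⊙H≈I : (U ⊙ E) ⊙ H ≋ I
    UE⊙H≈I i j = begin
      ((U ⊙ E) ⊙ H) i j                                  ≈⟨ ⊙-assoc U E H i j ⟩
      (U ⊙ (E ⊙ H)) i j                                  ≈⟨ ⊙-congˡ U (clear-first-column H (proj₂ pivot)) i j ⟩
      (U ⊙ block 1# x (λ _ → 0#) (schur y H)) i j        ≈⟨ unipotent-inverse x (proj₂ recursion) i j ⟩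
      I i j                                              ∎

  -- Hᵀ is unitriangular for the opposite order, so H also has a right inverse.
  right-inverse : ∀ n {_≤_ : Fin n → Fin n → Set ℓ′} → IsPartialOrder _≡_ _≤_ →
                  (H : Mat n) → IsUnitriangular _≤_ H → ∃ λ R → H ⊙ R ≋ I
  right-inverse n po H unit = proj₁ inverseᵀ ᵀ , transpose-inverse (proj₂ inverseᵀ)
    where
    open IsUnitriangular unit
    unitᵀ : IsUnitriangular (flip _) (H ᵀ)
    unitᵀ = record { off-support = λ i j → off-support j i ; diagonal = diagonal }
    inverseᵀ : ∃ λ T → T ⊙ H ᵀ ≋ I
    inverseᵀ = left-inverse n (opposite po) (H ᵀ) unitᵀ

module Sweep {c ℓ : Level} (𝕂 : Field c ℓ) {n : ℕ} {_≤_ : Fin n → Fin n → Set ℓ′}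
             (po : IsPartialOrder _≡_ _≤_) (H : Matrix 𝕂 n)
             (unit : Unitriangular.IsUnitriangular 𝕂 _≤_ H) where
  open Field 𝕂
  open MatrixAlgebra 𝕂
  open Unitriangular 𝕂

  reduced : ℕ → Mat n
  reduced k i j with toℕ i <? k
  ... | yes _ = I i j
  ... | no _  = H i j

  -- Identity rows are unitriangular (by reflexivity), the others are rows of H.
  reduced-unitriangular : ∀ k → IsUnitriangular _≤_ (reduced k)
  reduced-unitriangular k = record { off-support = off-support′ ; diagonal = diagonal′ }
    where
    open IsUnitriangular unit
    open IsPartialOrder po using () renaming (reflexive to ≤-reflexive)
    off-support′ : ∀ i j → ¬ (i ≤ j) → ¬ ¬ (reduced k i j ≈ 0#)
    off-support′ i j i≰j with toℕ i <? k
    ... | yes _ = contradiction (𝟙-off (i≰j ∘ ≤-reflexive))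
    ... | no _  = off-support i j i≰j
    diagonal′ : ∀ i → ¬ ¬ (reduced k i i ≈ 1#)
    diagonal′ i with toℕ i <? k
    ... | yes _ = contradiction (𝟙-diag i)
    ... | no _  = diagonal i

  reduced-all : ∀ i j → reduced n i j ≈ I i j
  reduced-all i j with toℕ i <? n
  ... | yes _  = refl
  ... | no i≮n = contradiction (toℕ<n i) i≮n

  reduced-current : ∀ i j → reduced (suc (toℕ i)) i j ≈ I i j
  reduced-current i j with toℕ i <? suc (toℕ i)
  ... | yes _  = refl
  ... | no i≮i = contradiction (ℕₚ.n<1+n (toℕ i)) i≮i

  reduced-other : ∀ k i j → toℕ i ≢ k → reduced k i j ≈ reduced (suc k) i j
  reduced-other k i j i≢k with toℕ i <? k | toℕ i <? suc k
  ... | yes _   | yes _    = refl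
  ... | yes i<k | no i≮1+k = contradiction (ℕₚ.m<n⇒m<1+n i<k) i≮1+k
  ... | no i≮k  | yes i<1+k = contradiction (ℕₚ.≤-antisym (ℕₚ.≤-pred i<1+k) (ℕₚ.≮⇒≥ i≮k)) i≢k
  ... | no _    | no _     = refl

  reduced-inverse : ∀ k → ∃ λ T → T ⊙ reduced k ≋ I
  reduced-inverse k = left-inverse n po (reduced k) (reduced-unitriangular k)

  A : Mat n
  A v = proj₁ (reduced-inverse (toℕ v)) v

  A-row : ∀ v j → (A v ᵛ⊙ reduced (toℕ v)) j ≈ I v j
  A-row v = proj₂ (reduced-inverse (toℕ v)) v

  update-reduces : ∀ v → localMatrix 𝕂 A v ⊙ reduced (toℕ v) ≋ reduced (suc (toℕ v))
  update-reduces v i j with i ≟ v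
  ... | yes ≡.refl = trans (A-row i j) (sym (reduced-current i j))
  ... | no i≢v     = trans (∑-δˡ (λ l → reduced (toℕ v) l j) i)
                           (reduced-other (toℕ v) i j (i≢v ∘ toℕ-injective))

  step : Mat n → Fin n → Mat n
  step M v = localMatrix 𝕂 A v ⊙ M

  step-reduces : ∀ {k} v M → toℕ v ≡ k → M ⊙ H ≋ reduced k → step M v ⊙ H ≋ reduced (suc k)
  step-reduces v M ≡.refl MH≈R i j = begin
    ((F ⊙ M) ⊙ H) i j          ≈⟨ ⊙-assoc F M H i j ⟩
    (F ⊙ (M ⊙ H)) i j          ≈⟨ ⊙-congˡ F MH≈R i j ⟩
    (F ⊙ reduced (toℕ v)) i j  ≈⟨ update-reduces v i j ⟩
    reduced (suc (toℕ v)) i j  ∎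
    where
    open import Relation.Binary.Reasoning.Setoid setoid
    F : Mat n
    F = localMatrix 𝕂 A v

  sweep : ∀ m k M (f : Fin m → Fin n) → (∀ t → toℕ (f t) ≡ k ℕ.+ toℕ t) →
          M ⊙ H ≋ reduced k → foldl step M (tabulate f) ⊙ H ≋ reduced (k ℕ.+ m)
  sweep zero k M f _ MH≈R = ≡.subst (λ k′ → M ⊙ H ≋ reduced k′) (≡.sym (ℕₚ.+-identityʳ k)) MH≈R
  sweep (suc m) k M f f-index MH≈R =
    ≡.subst (λ k′ → foldl step M (tabulate f) ⊙ H ≋ reduced k′) (≡.sym (ℕₚ.+-suc k m))
      (sweep m (suc k) (step M (f fzero)) (f ∘ fsuc)
        (λ t → ≡.trans (f-index (fsuc t)) (ℕₚ.+-suc k (toℕ t)))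
        (step-reduces (f fzero) M (≡.trans (f-index fzero) (ℕₚ.+-identityʳ k)) MH≈R))

  sds : LinearSDS 𝕂 n
  sds = record
    { graph     = complete n
    ; connected = complete-connected n
    ; A         = A
    ; A-support = λ i j i≢j not-adjacent → contradiction (complete-adjacent i≢j) not-adjacent
    ; π         = Permutation.id
    }

  sds-left-inverse : systemMap 𝕂 sds ⊙ H ≋ I
  sds-left-inverse i j = trans (all-reduced i j) (reduced-all i j)
    where
    all-reduced : systemMap 𝕂 sds ⊙ H ≋ reduced n
    all-reduced = sweep n 0 I (λ k → k) (λ _ → ≡.refl) (λ i j → ⊙-identityˡ H i j)

proposition2 : ∀ {c ℓ ℓ′ : Level} (𝕂 : Field c ℓ) (n : ℕ)
                 (_≤_ : Fin n → Fin n → Set ℓ′) → IsPartialOrder _≡_ _≤_ →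
                 (H : Matrix 𝕂 n) →
                 (∀ i j → ¬ (i ≤ j) → Field._≈_ 𝕂 (H i j) (Field.0# 𝕂)) →
                 (∀ i → Field._≈_ 𝕂 (H i i) (Field.1# 𝕂)) →
                 ∃ λ (S : LinearSDS 𝕂 n) →
                   _≈ᴹ_ 𝕂 (_·_ 𝕂 (systemMap 𝕂 S) H) (𝟙 𝕂) × _≈ᴹ_ 𝕂 (_·_ 𝕂 H (systemMap 𝕂 S)) (𝟙 𝕂)
proposition2 𝕂 n _≤_ po H off-support diagonal =
  sds , sds-left-inverse , left-inverse-is-two-sided sds-left-inverse (proj₂ (right-inverse n po H unit))
  where
  open MatrixAlgebra 𝕂 using (left-inverse-is-two-sided)
  open Unitriangular 𝕂 using (IsUnitriangular; right-inverse)
  unit : IsUnitriangular _≤_ H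
  unit = record { off-support = λ i j i≰j → contradiction (off-support i j i≰j)
                ; diagonal    = λ i → contradiction (diagonal i) }
  open Sweep 𝕂 po H unit using (sds; sds-left-inverse)
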